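{- Let $r_1, r_2 \geq 2$ and $k' \geq 1$ be integers, and let $s_1,\dots,s_{k'}$ be positive integers with $s_1,\dots,s_{k'-1}\geq r_2$ and $s_{k'}\leq r_2+1$. Assume: (i) for all positive integers $k$ and $n$ with $n\geq r_1k$, \[ \chi\left(\mathrm{KG}^{r_1}(n,k)_{r_1\textup{ -stab}}\right) \geq \frac{n-r_1(k-1)}{r_1-1}; \] (ii) for all integers $n$ with $n\geq s_1+\dots+s_{k'}$, \[ \chi\left(\mathrm{KG}^{r_2}(n,k')_{(s_1,\dots,s_{k'})\textup{ -stab}}\right) \geq \frac{n-\sum_{i=1}^{k'-1}s_i}{r_2-1}. \] Then, setting $r=r_1r_2$ and $\vec{s}=(r_1s_1,\dots,r_1s_{k'})$, for all integers $n\geq r_1(s_1+\dots+s_{k'})$, \[ \chi\left(\mathrm{KG}^{r}(n,k')_{\vec{s}\textup{ -stab}}\right) \geq \frac{n-r_1\sum_{i=1}^{k'-1}s_i}{r-1}. \]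
   Context: For a positive integer $n$, $[n]=\{1,\dots,n\}$. For a $k$-subset $A\subseteq[n]$, let $A(1)<\dots<A(k)$ be its elements in increasing order. For a vector $\vec{s}=(s_1,\dots,s_k)$ of positive integers, $A$ is $\vec{s}$-stable if $A(j+1)-A(j)\geq s_j$ for $1\leq j\leq k-1$ and $A(k)-A(1)\leq n-s_k$. For a positive integer $s$, "$s$-stable" means $(s,\dots,s)$-stable, i.e. $s\leq|i-j|\leq n-s$ for all distinct $i,j\in A$. For $r\geq 2$, the hypergraph $\mathrm{KG}^{r}(n,k)_{\vec{s}\textup{ -stab}}$ has as vertices all $\vec{s}$-stable $k$-subsets of $[n]$, and its hyperedges are all sets of $r$ pairwise disjoint such vertices. The chromatic number $\chi$ of a hypergraph is the least number of colors in a vertex coloring with no monochromatic hyperedge; by convention the chromatic number of the hypergraph with no vertices is $-\infty$. -}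

module Defs where

open import Data.Nat using (ℕ; zero; suc; _+_; _*_; _∸_; _≤_; _<_)
open import Data.Fin using (Fin; toℕ)
open import Data.Product using (Σ; _×_; ∃)
open import Relation.Binary.PropositionalEquality using (_≡_; _≢_)
open import Relation.Nullary using (¬_)

-- A k-subset A of [n] = {1,…,n}, listed increasingly: A(i) = elems (i).
-- (Index i : Fin k corresponds to position i+1 in the paper.)
record KSubset (n k : ℕ) : Set where
  field
    elems   : Fin k → ℕ
    inRange : ∀ i → 1 ≤ elems i × elems i ≤ n
    strict  : ∀ (i j : Fin k) → toℕ i < toℕ j → elems i < elems j
open KSubset public

-- A is s⃗-stable (s⃗ = (s₁,…,s_k)):
--   A(j+1) − A(j) ≥ s_j  for consecutive positions, and
--   A(k) − A(1) ≤ n − s_k, written without truncated subtraction as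
--   A(k) + s_k ≤ A(1) + n.
record Stable (n k : ℕ) (s : Fin k → ℕ) (A : KSubset n k) : Set where
  field
    gaps : ∀ (i j : Fin k) → toℕ j ≡ suc (toℕ i) →
           elems A i + s i ≤ elems A j
    wrap : ∀ (i j : Fin k) → toℕ i ≡ 0 → toℕ j ≡ k ∸ 1 →
           elems A j + s j ≤ elems A i + n

Vertex : (n k : ℕ) → (Fin k → ℕ) → Set
Vertex n k s = Σ (KSubset n k) (Stable n k s)

elemsV : ∀ {n k s} → Vertex n k s → Fin k → ℕ
elemsV v = elems (Data.Product.proj₁ v)

Disjoint : ∀ {n k s} → Vertex n k s → Vertex n k s → Set
Disjoint u v = ∀ i j → elemsV u i ≢ elemsV v j

-- A hyperedge of KG^r(n,k)_{s⃗-stab}: r pairwise disjoint vertices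
-- (listed by Fin r; pairwise disjointness of nonempty sets forces them
-- to be distinct, so this is exactly an r-element set of such vertices).
IsHyperedge : (r : ℕ) → ∀ {n k s} → (Fin r → Vertex n k s) → Set
IsHyperedge r e = ∀ (a b : Fin r) → a ≢ b → Disjoint (e a) (e b)

ProperColoring : (r n k : ℕ) (s : Fin k → ℕ) (c : ℕ) →
                 (Vertex n k s → Fin c) → Set
ProperColoring r n k s c col =
  ∀ (e : Fin r → Vertex n k s) → IsHyperedge r e →
    ¬ (∀ (a b : Fin r) → col (e a) ≡ col (e b))

-- "χ(KG^r(n,k)_{s⃗-stab}) ≥ (N − A)/d" (for d ≥ 1).
-- χ is the least c admitting a proper c-coloring, and χ = −∞ when the
-- vertex set is empty. Hence χ ≥ (N − A)/d iff the vertex set is nonempty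
-- and every c admitting a proper c-coloring satisfies c ≥ (N − A)/d,
-- i.e. (clearing the positive denominator d) N ≤ c·d + A.
ChiAtLeast : (r n k : ℕ) (s : Fin k → ℕ) (N A d : ℕ) → Set
ChiAtLeast r n k s N A d =
  Vertex n k s ×
  (∀ (c : ℕ) (col : Vertex n k s → Fin c) →
     ProperColoring r n k s c col → N ≤ c * d + A)

-- If X = {x₁ < … < x_L} is an r₁-stable L-subset of [n] and B an s⃗-stable k'-subset of [L],
-- then X∘B = {x_b : b ∈ B} is an (r₁s⃗)-stable k'-subset of [n]; composites are disjoint when
-- the X's are disjoint, or when they share X and the B's are disjoint.
-- Given a proper c-colouring of KG^{r₁r₂}(n,k')_{r₁s⃗}, let L = c(r₂−1) + S + 1 with
-- S = s₁ + … + s_{k'−1}. By (ii), for each X the colouring B ↦ col(X∘B) of KG^{r₂}(L,k')_{s⃗}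
-- has a monochromatic hyperedge; giving X its colour is a proper c-colouring of
-- KG^{r₁}(n,L)_{r₁-stab}, since r₁ disjoint X's of one colour would yield r₁r₂ disjoint
-- composites of one colour. So (i) gives n ≤ c(r₁−1) + r₁(L−1) = c(r₁r₂−1) + r₁S, unless
-- n < r₁L, which is better still. If s_{k'} > c(r₂−1) + 1 then c = 1, while the same argument
-- with L = S + s_{k'} forces c ≥ 2.

module Submission where

open import Defs
open import Data.Nat using (ℕ; zero; suc; pred; >-nonZero; _+_; _*_; _∸_; _≤_; _<_; _≤?_; _<?_; z≤n; s≤s; s≤s⁻¹)
open import Data.Nat.Properties
open import Data.Nat.Tactic.RingSolver using (solve-∀)
open import Data.Fin using (Fin; toℕ; fromℕ; fromℕ<; inject₁; remQuot; combine)
  renaming (zero to fzero; suc to fsuc)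
open import Data.Fin.Properties
  using (toℕ-injective; toℕ-fromℕ<; toℕ-fromℕ; toℕ-inject₁; toℕ≤pred[n]; any?; all?; combine-remQuot)
  renaming (_≟_ to _≟ᶠ_)
open import Data.Vec using (Vec; []; _∷_; lookup; tabulate; map; sum; _∷ʳ_)
open import Data.Vec.Properties using (lookup∘tabulate; lookup-map)
open import Data.Vec.Relation.Unary.All using (All)
open import Data.Maybe using (Maybe; just; nothing)
import Data.Maybe as Maybe
open import Data.Maybe.Properties using (just-injective; ≡-dec)
open import Data.Product using (Σ; ∃; _×_; _,_; proj₁; proj₂; uncurry)
open import Data.Sum using (inj₁; inj₂)
open import Function using (_∘_)
open import Relation.Binary.PropositionalEquality
open import Relation.Binary using (tri<; tri≈; tri>)
open import Relation.Nullary using (¬_; Dec; yes; no; contradiction)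
open import Relation.Nullary.Decidable using (map′; _×-dec_; _→-dec_; ¬?; decidable-stable)
open import Relation.Unary using (Decidable)

IsVertex : (n k : ℕ) → (Fin k → ℕ) → (Fin k → ℕ) → Set
IsVertex n k s f =
  (∀ i → 1 ≤ f i × f i ≤ n) ×
  (∀ i j → toℕ i < toℕ j → f i < f j) ×
  (∀ i j → toℕ j ≡ suc (toℕ i) → f i + s i ≤ f j) ×
  (∀ i j → toℕ i ≡ 0 → toℕ j ≡ k ∸ 1 → f j + s j ≤ f i + n)

isVertex? : ∀ n k s → Decidable (IsVertex n k s)
isVertex? n k s f =
  all? (λ i → 1 ≤? f i ×-dec f i ≤? n) ×-dec
  all? (λ i → all? λ j → toℕ i <? toℕ j →-dec f i <? f j) ×-dec
  all? (λ i → all? λ j → toℕ j ≟ suc (toℕ i) →-dec f i + s i ≤? f j) ×-dec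
  all? (λ i → all? λ j → toℕ i ≟ 0 →-dec (toℕ j ≟ k ∸ 1 →-dec f j + s j ≤? f i + n))

module _ {n k : ℕ} {s : Fin k → ℕ} where

  toVertex : ∀ {f} → IsVertex n k s f → Vertex n k s
  toVertex {f} (range , increasing , gaps , wrap) =
    record { elems = f ; inRange = range ; strict = increasing } ,
    record { gaps = gaps ; wrap = wrap }

  isVertex : (u : Vertex n k s) → IsVertex n k s (elemsV u)
  isVertex (A , st) = inRange A , strict A , Stable.gaps st , Stable.wrap st

  IsVertex-resp : ∀ {f g} → (∀ i → f i ≡ g i) → IsVertex n k s f → IsVertex n k s g
  IsVertex-resp f≗g (range , increasing , gaps , wrap) =
    (λ i → subst (λ x → 1 ≤ x × x ≤ n) (f≗g i) (range i)) ,
    (λ i j h → subst₂ _<_ (f≗g i) (f≗g j) (increasing i j h)) ,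
    (λ i j h → subst₂ (λ x y → x + s i ≤ y) (f≗g i) (f≗g j) (gaps i j h)) ,
    (λ i j h₁ h₂ → subst₂ (λ x y → x + s j ≤ y + n) (f≗g j) (f≗g i) (wrap i j h₁ h₂))

Exhaustible : Set → Set₁
Exhaustible A = ∀ {P : A → Set} → Decidable P → Dec (∃ P)

Vec-exhaustible : ∀ {A} → Exhaustible A → ∀ k → Exhaustible (Vec A k)
Vec-exhaustible any-A? zero P? = map′ ([] ,_) (λ { ([] , p) → p }) (P? [])
Vec-exhaustible any-A? (suc k) P? =
  map′ (λ { (x , xs , p) → x ∷ xs , p }) (λ { (x ∷ xs , p) → x , xs , p })
       (any-A? λ x → Vec-exhaustible any-A? k λ xs → P? (x ∷ xs))

Code : ℕ → ℕ → Set
Code n k = Vec (Fin (suc n)) k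

elemsᶜ : ∀ {n k} → Code n k → Fin k → ℕ
elemsᶜ v i = toℕ (lookup v i)

module _ {n k : ℕ} {s : Fin k → ℕ} where

  codeOf : Vertex n k s → Code n k
  codeOf u = tabulate λ i → fromℕ< (s≤s (proj₂ (inRange (proj₁ u) i)))

  elemsᶜ-codeOf : ∀ u i → elemsᶜ (codeOf u) i ≡ elemsV u i
  elemsᶜ-codeOf u i = trans (cong toℕ (lookup∘tabulate _ i)) (toℕ-fromℕ< _)

  decode : Code n k → Maybe (Vertex n k s)
  decode v with isVertex? n k s (elemsᶜ v)
  ... | yes ok = just (toVertex ok)
  ... | no _  = nothing

  decode-valid : ∀ v → IsVertex n k s (elemsᶜ v) →
                 Σ (Vertex n k s) λ u → decode v ≡ just u × elemsV u ≡ elemsᶜ v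
  decode-valid v ok with isVertex? n k s (elemsᶜ v)
  ... | yes ok′ = toVertex ok′ , refl , refl
  ... | no ¬ok  = contradiction ok ¬ok

  canonical : Vertex n k s → Vertex n k s
  canonical u = proj₁ (decode-valid (codeOf u) (IsVertex-resp (sym ∘ elemsᶜ-codeOf u) (isVertex u)))

MonochromaticHyperedge : ∀ r {n k s c} → (Vertex n k s → Fin c) → (Fin r → Vertex n k s) → Set
MonochromaticHyperedge r col e = IsHyperedge r e × (∀ a b → col (e a) ≡ col (e b))

-- Constructively, a monochromatic hyperedge has to be found by exhaustive search over codes.
-- If the search fails then col ∘ canonical is proper: it depends on the elements of a vertex only,
-- so a monochromatic hyperedge of it would show up among the codes.
module MonochromaticSearch {r n k : ℕ} {s : Fin k → ℕ} {c : ℕ} (col : Vertex n k s → Fin c) where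

  colourᶜ : Code n k → Maybe (Fin c)
  colourᶜ v = Maybe.map col (decode v)

  MonochromaticCodes : Vec (Code n k) r → Set
  MonochromaticCodes E =
    (∀ a → IsVertex n k s (elemsᶜ (lookup E a))) ×
    (∀ a b → a ≢ b → ∀ i j → lookup (lookup E a) i ≢ lookup (lookup E b) j) ×
    (∀ a b → colourᶜ (lookup E a) ≡ colourᶜ (lookup E b))

  monochromaticCodes? : Decidable MonochromaticCodes
  monochromaticCodes? E =
    all? (λ a → isVertex? n k s _) ×-dec
    all? (λ a → all? λ b → ¬? (a ≟ᶠ b) →-dec all? λ i → all? λ j → ¬? (lookup (lookup E a) i ≟ᶠ lookup (lookup E b) j)) ×-dec
    all? (λ a → all? λ b → ≡-dec _≟ᶠ_ (colourᶜ (lookup E a)) (colourᶜ (lookup E b)))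

  from-codes : ∃ MonochromaticCodes → ∃ (MonochromaticHyperedge r col)
  from-codes (E , valid , disjoint , mono) = e , hyperedge , λ a b → just-injective (colour a b)
    where
    decoded = λ a → decode-valid (lookup E a) (valid a)
    e : Fin r → Vertex n k s
    e a = proj₁ (decoded a)
    hyperedge : IsHyperedge r e
    hyperedge a b a≢b i j eq
      rewrite proj₂ (proj₂ (decoded a)) | proj₂ (proj₂ (decoded b)) = disjoint a b a≢b i j (toℕ-injective eq)
    colour : ∀ a b → just (col (e a)) ≡ just (col (e b))
    colour a b = trans (sym (cong (Maybe.map col) (proj₁ (proj₂ (decoded a)))))
                (trans (mono a b) (cong (Maybe.map col) (proj₁ (proj₂ (decoded b)))))

  codes-exist : ¬ ProperColoring r n k s c (col ∘ canonical) → ¬ ¬ ∃ MonochromaticCodes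
  codes-exist improper none = improper proper
    where
    proper : ProperColoring r n k s c (col ∘ canonical)
    proper e hyperedge mono = none (E , valid , disjoint , monoE)
      where
      E = tabulate (codeOf ∘ e)
      valid : ∀ a → IsVertex n k s (elemsᶜ (lookup E a))
      valid a rewrite lookup∘tabulate (codeOf ∘ e) a =
        IsVertex-resp (sym ∘ elemsᶜ-codeOf (e a)) (isVertex (e a))
      disjoint : ∀ a b → a ≢ b → ∀ i j → lookup (lookup E a) i ≢ lookup (lookup E b) j
      disjoint a b a≢b i j
        rewrite lookup∘tabulate (codeOf ∘ e) a | lookup∘tabulate (codeOf ∘ e) b = λ eq →
          hyperedge a b a≢b i j (trans (sym (elemsᶜ-codeOf (e a) i)) (trans (cong toℕ eq) (elemsᶜ-codeOf (e b) j)))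
      colourᶜ-E : ∀ a → colourᶜ (lookup E a) ≡ just (col (canonical (e a)))
      colourᶜ-E a rewrite lookup∘tabulate (codeOf ∘ e) a =
        cong (Maybe.map col) (proj₁ (proj₂ (decode-valid (codeOf (e a)) _)))
      monoE : ∀ a b → colourᶜ (lookup E a) ≡ colourᶜ (lookup E b)
      monoE a b = trans (colourᶜ-E a) (trans (cong just (mono a b)) (sym (colourᶜ-E b)))

-- Opaque so that the type checker never evaluates the search.
opaque
  monochromatic-hyperedge : ∀ {r n k s c} (col : Vertex n k s → Fin c) →
    (∀ col′ → ¬ ProperColoring r n k s c col′) → ∃ (MonochromaticHyperedge r col)
  monochromatic-hyperedge {r} {n} {k} col improper =
    from-codes (decidable-stable (Vec-exhaustible (Vec-exhaustible any? k) r monochromaticCodes?)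
                                 (codes-exist (improper (col ∘ canonical))))
    where open MonochromaticSearch {r} col

module _ {n k : ℕ} (A : KSubset n k) where

  elems-injective : ∀ {i j} → elems A i ≡ elems A j → i ≡ j
  elems-injective {i} {j} eq with <-cmp (toℕ i) (toℕ j)
  ... | tri< i<j _ _ = contradiction eq (<⇒≢ (strict A i j i<j))
  ... | tri≈ _ i≡j _ = toℕ-injective i≡j
  ... | tri> _ _ j<i = contradiction eq (>⇒≢ (strict A j i j<i))

  elems-mono : ∀ {i j} → toℕ i ≤ toℕ j → elems A i ≤ elems A j
  elems-mono {i} {j} i≤j with m≤n⇒m<n∨m≡n i≤j
  ... | inj₁ i<j = <⇒≤ (strict A i j i<j)
  ... | inj₂ i≡j = ≤-reflexive (cong (elems A) (toℕ-injective i≡j))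

  slot : Fin k → Fin n
  slot i = fromℕ< (pred< (inRange A i))
    where
    pred< : ∀ {x} → 1 ≤ x × x ≤ n → pred x < n
    pred< {suc x} (_ , x≤n) = x≤n

  suc-toℕ-slot : ∀ i → suc (toℕ (slot i)) ≡ elems A i
  suc-toℕ-slot i = trans (cong suc (toℕ-fromℕ< _)) (suc-pred′ (proj₁ (inRange A i)))
    where
    suc-pred′ : ∀ {x} → 1 ≤ x → suc (pred x) ≡ x
    suc-pred′ {suc x} _ = refl

  via-slots : ∀ (R : ℕ → ℕ → Set) {i j} → R (elems A i) (elems A j) →
              R (suc (toℕ (slot i))) (suc (toℕ (slot j)))
  via-slots R = subst₂ R (sym (suc-toℕ-slot _)) (sym (suc-toℕ-slot _))

module _ {r n L : ℕ} (X : Vertex n L (λ _ → r)) where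

  private
    x = elemsV X

  spread : ∀ d {p q : Fin L} → toℕ p + d ≤ toℕ q → x p + r * d ≤ x q
  spread zero {p} {q} p≤q = begin
    x p + r * 0 ≡⟨ cong (x p +_) (*-zeroʳ r) ⟩
    x p + 0     ≡⟨ +-identityʳ (x p) ⟩
    x p         ≤⟨ elems-mono (proj₁ X) (subst (_≤ toℕ q) (+-identityʳ (toℕ p)) p≤q) ⟩
    x q         ∎
    where open ≤-Reasoning
  spread (suc d) {p} {fzero} p+d≤0 = contradiction (n≤0⇒n≡0 p+d≤0) (m+1+n≢0 (toℕ p))
  spread (suc d) {p} {fsuc q} p+d≤q = begin
    x p + r * suc d         ≡⟨ cong (x p +_) (*-suc r d) ⟩
    x p + (r + r * d)       ≡⟨ swap (x p) r (r * d) ⟩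
    (x p + r * d) + r       ≤⟨ +-monoˡ-≤ r (spread d p+d≤q′) ⟩
    x (inject₁ q) + r       ≤⟨ Stable.gaps (proj₂ X) (inject₁ q) (fsuc q) (cong suc (sym (toℕ-inject₁ q))) ⟩
    x (fsuc q)              ∎
    where
    open ≤-Reasoning
    swap : ∀ a b c → a + (b + c) ≡ (a + c) + b
    swap = solve-∀
    p+d≤q′ : toℕ p + d ≤ toℕ (inject₁ q)
    p+d≤q′ = subst (toℕ p + d ≤_) (sym (toℕ-inject₁ q)) (s≤s⁻¹ (subst (_≤ suc (toℕ q)) (+-suc (toℕ p) d) p+d≤q))

spread-around : ∀ {r n L} (X : Vertex n L (λ _ → r)) d {p q : Fin L} →
                toℕ q + d ≤ toℕ p + L → elemsV X q + r * d ≤ elemsV X p + n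
spread-around {L = zero} X d {()}
spread-around {r} {n} {suc K} X d {p} {q} q+d≤p+L = begin
  x q + r * d                         ≤⟨ +-monoʳ-≤ (x q) (*-monoʳ-≤ r d≤) ⟩
  x q + r * (e + suc (toℕ p))         ≡⟨ rearrange (x q) r e (toℕ p) ⟩
  (x q + r * e) + r + r * toℕ p       ≤⟨ +-monoˡ-≤ (r * toℕ p) (+-monoˡ-≤ r (spread X e (≤-reflexive q+e≡last))) ⟩
  x (fromℕ K) + r + r * toℕ p         ≤⟨ +-monoˡ-≤ (r * toℕ p) (Stable.wrap (proj₂ X) fzero (fromℕ K) refl (toℕ-fromℕ K)) ⟩
  x fzero + n + r * toℕ p             ≡⟨ swap (x fzero) n (r * toℕ p) ⟩
  (x fzero + r * toℕ p) + n           ≤⟨ +-monoˡ-≤ n (spread X (toℕ p) ≤-refl) ⟩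
  x p + n                             ∎
  where
  open ≤-Reasoning
  x = elemsV X
  e = K ∸ toℕ q
  q+e≡K : toℕ q + e ≡ K
  q+e≡K = m+[n∸m]≡n (toℕ≤pred[n] q)
  q+e≡last : toℕ q + e ≡ toℕ (fromℕ K)
  q+e≡last = trans q+e≡K (sym (toℕ-fromℕ K))
  d≤ : d ≤ e + suc (toℕ p)
  d≤ = +-cancelˡ-≤ (toℕ q) d _ (≤-trans q+d≤p+L (≤-reflexive (begin-equality
         toℕ p + suc K               ≡⟨ cong (λ y → toℕ p + suc y) (sym q+e≡K) ⟩
         toℕ p + suc (toℕ q + e)     ≡⟨ shuffle (toℕ p) (toℕ q) e ⟩
         toℕ q + (e + suc (toℕ p))   ∎)))
    where
    shuffle : ∀ a b c → a + suc (b + c) ≡ b + (c + suc a)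
    shuffle = solve-∀
  rearrange : ∀ a b c d → a + b * (c + suc d) ≡ (a + b * c) + b + b * d
  rearrange = solve-∀
  swap : ∀ a b c → a + b + c ≡ (a + c) + b
  swap = solve-∀

module _ {r n L : ℕ} (X : Vertex n L (λ _ → r)) where

  compose : ∀ {k s} → Vertex L k s → Vertex n k (λ i → r * s i)
  compose {k} {s} (B , stable) =
    record { elems = elemsV X ∘ slot B ; inRange = inRange (proj₁ X) ∘ slot B ; strict = increasing } ,
    record { gaps = gaps ; wrap = wrap }
    where
    increasing : ∀ i j → toℕ i < toℕ j → elemsV X (slot B i) < elemsV X (slot B j)
    increasing i j i<j =
      strict (proj₁ X) (slot B i) (slot B j) (s≤s⁻¹ (via-slots B _<_ (strict B i j i<j)))
    gaps : ∀ i j → toℕ j ≡ suc (toℕ i) → elemsV X (slot B i) + r * s i ≤ elemsV X (slot B j)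
    gaps i j j≡1+i =
      spread X (s i) (s≤s⁻¹ (via-slots B (λ u v → u + s i ≤ v) (Stable.gaps stable i j j≡1+i)))
    wrap : ∀ i j → toℕ i ≡ 0 → toℕ j ≡ k ∸ 1 → elemsV X (slot B j) + r * s j ≤ elemsV X (slot B i) + n
    wrap i j i≡0 j≡k-1 =
      spread-around X (s j) (s≤s⁻¹ (via-slots B (λ u v → u + s j ≤ v + L) (Stable.wrap stable i j i≡0 j≡k-1)))

  compose-disjointʳ : ∀ {k s} {B B′ : Vertex L k s} → Disjoint B B′ → Disjoint (compose B) (compose B′)
  compose-disjointʳ {B = B , _} {B′ , _} disjoint i j eq =
    disjoint i j (trans (sym (suc-toℕ-slot B i)) (trans (cong (suc ∘ toℕ) (elems-injective (proj₁ X) eq)) (suc-toℕ-slot B′ j)))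

compose-disjointˡ : ∀ {r n L k s} {X X′ : Vertex n L (λ _ → r)} (B B′ : Vertex L k s) →
                    Disjoint X X′ → Disjoint (compose X B) (compose X′ B′)
compose-disjointˡ (B , _) (B′ , _) disjoint i j = disjoint (slot B i) (slot B′ j)

remQuot-injective : ∀ {m} n {ι ι′ : Fin (m * n)} → remQuot {m} n ι ≡ remQuot n ι′ → ι ≡ ι′
remQuot-injective {m} n {ι} {ι′} eq =
  trans (sym (combine-remQuot {m} n ι)) (trans (cong (uncurry combine) eq) (combine-remQuot {m} n ι′))

composites-hyperedge :
  ∀ {r₁ r₂ n L k s} (Xs : Fin r₁ → Vertex n L (λ _ → r₁)) (e : Fin r₁ → Fin r₂ → Vertex L k s) →
  IsHyperedge r₁ Xs → (∀ p → IsHyperedge r₂ (e p)) →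
  IsHyperedge (r₁ * r₂) (λ ι → uncurry (λ p a → compose (Xs p) (e p a)) (remQuot r₂ ι))
composites-hyperedge {r₁} {r₂} Xs e Xs-hyperedge e-hyperedge ι ι′ ι≢ι′ =
  disjoint (ι≢ι′ ∘ remQuot-injective {r₁} r₂)
  where
  disjoint : ∀ {p p′ a a′} → (p , a) ≢ (p′ , a′) →
             Disjoint (compose (Xs p) (e p a)) (compose (Xs p′) (e p′ a′))
  disjoint {p} {p′} {a} {a′} pa≢pa′ with p ≟ᶠ p′
  ... | no p≢p′  = compose-disjointˡ {X = Xs p} {Xs p′} (e p a) (e p′ a′) (Xs-hyperedge p p′ p≢p′)
  ... | yes refl = compose-disjointʳ (Xs p) {B = e p a} {e p a′} (e-hyperedge p a a′ (pa≢pa′ ∘ cong (p ,_)))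

colouring-by-composition :
  ∀ {r₁ r₂ n L k s c} → 1 ≤ r₂ →
  (∀ col′ → ¬ ProperColoring r₂ L k s c col′) →
  (col : Vertex n k (λ i → r₁ * s i) → Fin c) → ProperColoring (r₁ * r₂) n k (λ i → r₁ * s i) c col →
  Σ (Vertex n L (λ _ → r₁) → Fin c) (ProperColoring r₁ n L (λ _ → r₁) c)
colouring-by-composition {r₁} {suc r₂} {n} {L} {k} {s} {c} (s≤s z≤n) improper col proper = colourX , properX
  where
  edge : (X : Vertex n L (λ _ → r₁)) → ∃ (MonochromaticHyperedge (suc r₂) (col ∘ compose X))
  edge X = monochromatic-hyperedge (col ∘ compose X) improper

  colourX : Vertex n L (λ _ → r₁) → Fin c
  colourX X = col (compose X (proj₁ (edge X) fzero))

  properX : ProperColoring r₁ n L (λ _ → r₁) c colourX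
  properX Xs hyperedge mono = proper H H-hyperedge H-mono
    where
    e : Fin r₁ → Fin (suc r₂) → Vertex L k s
    e p = proj₁ (edge (Xs p))

    position : Fin (r₁ * suc r₂) → Fin r₁ × Fin (suc r₂)
    position = remQuot (suc r₂)

    H : Fin (r₁ * suc r₂) → Vertex n k (λ i → r₁ * s i)
    H ι = uncurry (λ p a → compose (Xs p) (e p a)) (position ι)

    colour : ∀ ι → col (H ι) ≡ colourX (Xs (proj₁ (position ι)))
    colour ι = proj₂ (proj₂ (edge (Xs (proj₁ (position ι))))) (proj₂ (position ι)) fzero

    H-mono : ∀ ι ι′ → col (H ι) ≡ col (H ι′)
    H-mono ι ι′ = trans (colour ι) (trans (mono (proj₁ (position ι)) (proj₁ (position ι′))) (sym (colour ι′)))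

    H-hyperedge : IsHyperedge (r₁ * suc r₂) H
    H-hyperedge = composites-hyperedge Xs e hyperedge (proj₁ ∘ proj₂ ∘ edge ∘ Xs)

module _ {n k : ℕ} {s s′ : Fin k → ℕ} (s≗s′ : ∀ i → s i ≡ s′ i) where

  Vertex-resp : Vertex n k s → Vertex n k s′
  Vertex-resp (A , stable) = A , record
    { gaps = λ i j h → subst (λ y → elems A i + y ≤ elems A j) (s≗s′ i) (Stable.gaps stable i j h)
    ; wrap = λ i j h₁ h₂ → subst (λ y → elems A j + y ≤ elems A i + n) (s≗s′ j) (Stable.wrap stable i j h₁ h₂) }

  ChiAtLeast-resp : ∀ {r N B d} → ChiAtLeast r n k s N B d → ChiAtLeast r n k s′ N B d
  ChiAtLeast-resp (v , bound) =
    Vertex-resp v , λ c col proper → bound c (col ∘ Vertex-resp) (λ e hyperedge → proper (Vertex-resp ∘ e) hyperedge)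

bound-below-r*L : ∀ {r L c n} → 1 ≤ L → 1 ≤ c → n < r * L → n ≤ c * (r ∸ 1) + r * (L ∸ 1)
bound-below-r*L {zero} _ _ ()
bound-below-r*L {suc a} {suc K} {suc c} {n} _ _ n<rL = begin
  n                   ≤⟨ s≤s⁻¹ (subst (n <_) (expand a K) n<rL) ⟩
  a + suc a * K       ≤⟨ +-monoˡ-≤ (suc a * K) (m≤n*m a (suc c)) ⟩
  suc c * a + suc a * K ∎
  where
  open ≤-Reasoning
  expand : ∀ a K → suc a * suc K ≡ suc (a + suc a * K)
  expand = solve-∀

bound-above-r*L⇒2≤c : ∀ {r L c n} → 1 ≤ r → 1 ≤ L → r * L ≤ n → n ≤ c * (r ∸ 1) + r * (L ∸ 1) → 2 ≤ c
bound-above-r*L⇒2≤c {suc a} {suc K} {c} _ _ rL≤n n≤ =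
  at-least-two c (+-cancelʳ-≤ (suc a * K) (suc a) (c * a)
    (subst (_≤ c * a + suc a * K) (*-suc (suc a) K) (≤-trans rL≤n n≤)))
  where
  at-least-two : ∀ c → suc a ≤ c * a → 2 ≤ c
  at-least-two zero          ()
  at-least-two (suc zero)    a<a = contradiction (subst (suc a ≤_) (+-identityʳ a) a<a) (<-irrefl refl)
  at-least-two (suc (suc _)) _   = s≤s (s≤s z≤n)

2≤c⇒t≤1+c*[r∸1] : ∀ {c r t} → 2 ≤ c → 2 ≤ r → t ≤ r + 1 → t ≤ suc (c * (r ∸ 1))
2≤c⇒t≤1+c*[r∸1] {suc (suc c)} {suc (suc b)} (s≤s (s≤s z≤n)) (s≤s (s≤s z≤n)) t≤r+1 =
  ≤-trans t≤r+1 (s≤s (+-monoʳ-≤ (suc b) (s≤s z≤n)))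

stacked-bound-≡ : ∀ {r₁ r₂} c S → 1 ≤ r₁ → 1 ≤ r₂ →
                c * (r₁ ∸ 1) + r₁ * (c * (r₂ ∸ 1) + S) ≡ c * (r₁ * r₂ ∸ 1) + r₁ * S
stacked-bound-≡ {suc a} {suc b} c S _ _ = identity a b c S
  where
  identity : ∀ a b c S → c * a + suc a * (c * b + S) ≡ c * (b + a * suc b) + suc a * S
  identity = solve-∀

composition-bound :
  ∀ {r₁ r₂ n L k s c} → 1 ≤ r₂ → 1 ≤ L → 1 ≤ c →
  (r₁ * L ≤ n → ChiAtLeast r₁ n L (λ _ → r₁) n (r₁ * (L ∸ 1)) (r₁ ∸ 1)) →
  (∀ col′ → ¬ ProperColoring r₂ L k s c col′) →
  (col : Vertex n k (λ i → r₁ * s i) → Fin c) → ProperColoring (r₁ * r₂) n k (λ i → r₁ * s i) c col →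
  n ≤ c * (r₁ ∸ 1) + r₁ * (L ∸ 1)
composition-bound {r₁} {n = n} {L} {c = c} 1≤r₂ 1≤L 1≤c chi improper col proper with r₁ * L ≤? n
... | no  r₁L≰n = bound-below-r*L {r₁} 1≤L 1≤c (≰⇒> r₁L≰n)
... | yes r₁L≤n = uncurry (proj₂ (chi r₁L≤n) c) (colouring-by-composition 1≤r₂ improper col proper)

lemma2 : (r₁ r₂ m : ℕ) (s : Vec ℕ m) (t : ℕ) →
    2 ≤ r₁ → 2 ≤ r₂ →
    All (λ x → 1 ≤ x) s → 1 ≤ t →
    All (λ x → r₂ ≤ x) s → t ≤ r₂ + 1 →
    (∀ (k n : ℕ) → 1 ≤ k → 1 ≤ n → r₁ * k ≤ n →
      ChiAtLeast r₁ n k (λ _ → r₁) n (r₁ * (k ∸ 1)) (r₁ ∸ 1)) →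
    (∀ (n : ℕ) → sum s + t ≤ n →
      ChiAtLeast r₂ n (suc m) (lookup (s ∷ʳ t)) n (sum s) (r₂ ∸ 1)) →
    ∀ (n : ℕ) → r₁ * (sum s + t) ≤ n →
      ChiAtLeast (r₁ * r₂) n (suc m) (lookup (map (r₁ *_) (s ∷ʳ t)))
        n (r₁ * sum s) (r₁ * r₂ ∸ 1)
-- The bounds on s₁, …, s_{k'-1} only serve to make hypothesis (ii) true; the argument never uses them.
lemma2 r₁ r₂ m s t 2≤r₁ 2≤r₂ _ 1≤t _ t≤r₂+1 chi₁ chi₂ n r₁[S+t]≤n =
  ChiAtLeast-resp (λ i → sym (lookup-map i (r₁ *_) (s ∷ʳ t))) (vertex , bound)
  where
  S = sum s
  1≤r₁ = <⇒≤ 2≤r₁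
  1≤r₂ = <⇒≤ 2≤r₂
  1≤S+t = ≤-trans 1≤t (m≤n+m t S)
  1≤n = ≤-trans 1≤S+t (≤-trans (m≤n*m (S + t) r₁ {{>-nonZero 1≤r₁}}) r₁[S+t]≤n)

  vertex : Vertex n (suc m) (λ i → r₁ * lookup (s ∷ʳ t) i)
  vertex = compose (proj₁ (chi₁ (S + t) n 1≤S+t 1≤n r₁[S+t]≤n)) (proj₁ (chi₂ (S + t) ≤-refl))

  improper : ∀ {c} L → S + t ≤ L → c * (r₂ ∸ 1) + S < L →
             ∀ col → ¬ ProperColoring r₂ L (suc m) (lookup (s ∷ʳ t)) c col
  improper L S+t≤L large col proper = <⇒≱ large (proj₂ (chi₂ L S+t≤L) _ col proper)

  bound : ∀ c col → ProperColoring (r₁ * r₂) n (suc m) (λ i → r₁ * lookup (s ∷ʳ t) i) c col →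
          n ≤ c * (r₁ * r₂ ∸ 1) + r₁ * S
  bound zero col _ with col vertex
  ... | ()
  bound c@(suc _) col proper with t ≤? suc (c * (r₂ ∸ 1))
  ... | yes t-fits = subst (n ≤_) (stacked-bound-≡ c S 1≤r₁ 1≤r₂)
    (composition-bound {c = c} 1≤r₂ (s≤s z≤n) (s≤s z≤n) (chi₁ L n (s≤s z≤n) 1≤n) (improper L S+t≤L ≤-refl) col proper)
    where
    L = suc (c * (r₂ ∸ 1) + S)
    S+t≤L : S + t ≤ L
    S+t≤L = subst (S + t ≤_) (trans (+-suc S _) (cong suc (+-comm S _))) (+-monoʳ-≤ S t-fits)
  ... | no t-large = contradiction (2≤c⇒t≤1+c*[r∸1] (bound-above-r*L⇒2≤c {c = c} 1≤r₁ 1≤S+t r₁[S+t]≤n n≤) 2≤r₂ t≤r₂+1) t-large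
    where
    S<S+t : c * (r₂ ∸ 1) + S < S + t
    S<S+t = subst (suc (c * (r₂ ∸ 1) + S) ≤_) (+-comm t S) (+-monoˡ-≤ S (<⇒≤ (≰⇒> t-large)))
    n≤ : n ≤ c * (r₁ ∸ 1) + r₁ * (S + t ∸ 1)
    n≤ = composition-bound {c = c} 1≤r₂ 1≤S+t (s≤s z≤n) (chi₁ (S + t) n 1≤S+t 1≤n) (improper (S + t) ≤-refl S<S+t) col proper
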